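{- Let $d\ge1$, let $\mathbb{F}$ be a field and $X=\{x_1,\ldots,x_n\}$. Let $f\in\mathbb{F}_{\bar{A},\bar{C}}[X]$ be a non-zero polynomial of total degree $\le d$. Then $f$ is not a polynomial identity for $\mathbb{A}_d$.
   Context: $\mathbb{F}_{\bar{A},\bar{C}}[X]$ is the noncommutative, nonassociative polynomial algebra: the $\mathbb{F}$-vector space with basis the monomial $1$ and rooted full binary trees (internal nodes having designated left and right children) whose leaves are labeled by variables; the product of monomials $m_1,m_2$ is the tree with left subtree $m_1$ and right subtree $m_2$, extended bilinearly. Degree of a monomial = number of leaves; total degree of $f$ = max degree of a monomial with non-zero coefficient. Let $\mathbb{A}'_d=\mathbb{F}^{d(d+1)^2}$ with elements indexed $x[i,j,k]$, $1\le i,j\le d+1$, $1\le k\le d$, and product $z=x\circ y$ with $z[i,j,d]=0$, $z[i,j,k]=\sum_{l=1}^{d+1}x[i,l,k+1]y[l,j,k+1]$ for $1\le k\le d-1$. Let $\mathbb{A}_d=\{(a,\alpha):a\in\mathbb{A}'_d,\alpha\in\mathbb{F}\}\cong\mathbb{F}^{d(d+1)^2+1}$ with product $(a_1,\alpha_1)\cdot(a_2,\alpha_2)=(a_1\circ a_2+\alpha_1a_2+\alpha_2a_1,\alpha_1\alpha_2)$; its identity is $(\mathbf0,1)$. Evaluation: for $f=\sum_mc_mm$ and $b_1,\ldots,b_n\in\mathbb{A}_d$, $f(b)=\sum_mc_mm(b)$, where $1\mapsto(\mathbf0,1)$, $x_i\mapsto b_i$, and a monomial with left subtree $m_1$ and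 right subtree $m_2$ maps to $m_1(b)\cdot m_2(b)$. $f$ is a polynomial identity for $\mathbb{A}_d$ if $f(b)=0$ for all $b\in(\mathbb{A}_d)^n$. -}

module Defs where

open import Level using (Level; _⊔_)
open import Algebra.Bundles using (CommutativeRing)
open import Data.Nat using (ℕ; zero; suc; _≤_; _<_; _<?_) renaming (_+_ to _+ℕ_)
open import Data.Fin using (Fin; toℕ; fromℕ<)
open import Data.Product using (Σ; ∃; _×_; _,_; proj₁; proj₂)
open import Data.List using (List; []; _∷_)
open import Relation.Nullary using (¬_; Dec; yes; no)
open import Relation.Binary.PropositionalEquality using (_≡_; refl; cong; cong₂)

record Field (c ℓ : Level) : Set (Level.suc (c ⊔ ℓ)) where
  field
    commutativeRing : CommutativeRing c ℓ
  open CommutativeRing commutativeRing public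
  field
    1≉0     : ¬ (1# ≈ 0#)
    inverse : ∀ x → ¬ (x ≈ 0#) → ∃ λ y → x * y ≈ 1#

-- Monomials of F_{Ā,C̄}[x₁,…,xₙ]: the monomial 1, or a rooted full binary
-- tree (ordered children) whose leaves are labelled by variables.

data Tree (n : ℕ) : Set where
  leaf : Fin n → Tree n
  node : Tree n → Tree n → Tree n

data Mon (n : ℕ) : Set where
  one  : Mon n
  tree : Tree n → Mon n

leaves : ∀ {n} → Tree n → ℕ
leaves (leaf _)   = 1
leaves (node l r) = leaves l +ℕ leaves r

degree : ∀ {n} → Mon n → ℕ
degree one      = 0
degree (tree t) = leaves t

leaf-inj : ∀ {n} {i j : Fin n} → leaf i ≡ leaf j → i ≡ j
leaf-inj refl = refl

node-injˡ : ∀ {n} {a b c e : Tree n} → node a b ≡ node c e → a ≡ c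
node-injˡ refl = refl

node-injʳ : ∀ {n} {a b c e : Tree n} → node a b ≡ node c e → b ≡ e
node-injʳ refl = refl

_≟T_ : ∀ {n} (s t : Tree n) → Dec (s ≡ t)
leaf i ≟T leaf j with i Data.Fin.≟ j
... | yes refl = yes refl
... | no i≢j   = no λ eq → i≢j (leaf-inj eq)
leaf _ ≟T node _ _ = no λ ()
node _ _ ≟T leaf _ = no λ ()
node a b ≟T node c e with a ≟T c | b ≟T e
... | yes refl | yes refl = yes refl
... | no a≢c   | _        = no λ eq → a≢c (node-injˡ eq)
... | yes _    | no b≢e   = no λ eq → b≢e (node-injʳ eq)

tree-inj : ∀ {n} {s t : Tree n} → tree s ≡ tree t → s ≡ t
tree-inj refl = refl

_≟M_ : ∀ {n} (m m′ : Mon n) → Dec (m ≡ m′)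
one    ≟M one    = yes refl
one    ≟M tree _ = no λ ()
tree _ ≟M one    = no λ ()
tree s ≟M tree t with s ≟T t
... | yes refl = yes refl
... | no s≢t   = no λ eq → s≢t (tree-inj eq)

module _ {c ℓ} (F : Field c ℓ) where
  open Field F

  -- Polynomials: finite formal F-linear combinations of monomials,
  -- represented by a list of terms (coefficient, monomial).  Two such
  -- lists denote the same polynomial iff all coefficients agree.

  Poly : ℕ → Set c
  Poly n = List (Carrier × Mon n)

  coeff : ∀ {n} → Poly n → Mon n → Carrier
  coeff []            m = 0#
  coeff ((a , m′) ∷ f) m with m′ ≟M m
  ... | yes _ = a + coeff f m
  ... | no  _ = coeff f m

  NonZeroPoly : ∀ {n} → Poly n → Set ℓ
  NonZeroPoly {n} f = Σ (Mon n) λ m → ¬ (coeff f m ≈ 0#)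

  TotalDegree≤ : ∀ {n} → Poly n → ℕ → Set ℓ
  TotalDegree≤ {n} f d = (m : Mon n) → ¬ (coeff f m ≈ 0#) → degree m ≤ d

  Σ[<_] : ∀ k → (Fin k → Carrier) → Carrier
  Σ[< zero  ] g = 0#
  Σ[< suc k ] g = g Fin.zero + Σ[< k ] (λ i → g (Fin.suc i))

  -- The algebra A′_d = F^{d(d+1)²}: x[i,j,k], i,j ∈ Fin (d+1), k ∈ Fin d
  -- (0-based indices: Fin index k corresponds to the paper's k+1).

  A′ : ℕ → Set c
  A′ d = Fin (suc d) → Fin (suc d) → Fin d → Carrier

  _∘′_ : ∀ {d} → A′ d → A′ d → A′ d
  _∘′_ {d} x y i j k with suc (toℕ k) <? d
  ... | yes k+1<d = let k′ = fromℕ< k+1<d in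
                    Σ[< suc d ] (λ l → x i l k′ * y l j k′)
  ... | no  _     = 0#

  _+′_ : ∀ {d} → A′ d → A′ d → A′ d
  (x +′ y) i j k = x i j k + y i j k

  _·′_ : ∀ {d} → Carrier → A′ d → A′ d
  (a ·′ x) i j k = a * x i j k

  0′ : ∀ {d} → A′ d
  0′ i j k = 0#

  A : ℕ → Set c
  A d = A′ d × Carrier

  _⊙_ : ∀ {d} → A d → A d → A d
  (a₁ , α₁) ⊙ (a₂ , α₂) = ((a₁ ∘′ a₂) +′ (α₁ ·′ a₂)) +′ (α₂ ·′ a₁) , α₁ * α₂

  _⊕_ : ∀ {d} → A d → A d → A d
  (a₁ , α₁) ⊕ (a₂ , α₂) = a₁ +′ a₂ , α₁ + α₂

  _⊛_ : ∀ {d} → Carrier → A d → A d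
  c′ ⊛ (a , α) = c′ ·′ a , c′ * α

  𝟘 : ∀ {d} → A d
  𝟘 = 0′ , 0#

  𝟙 : ∀ {d} → A d
  𝟙 = 0′ , 1#

  _≈A_ : ∀ {d} → A d → A d → Set ℓ
  _≈A_ {d} (a , α) (b , β) = ((i j : Fin (suc d)) (k : Fin d) → a i j k ≈ b i j k) × α ≈ β

  evalT : ∀ {d n} → (Fin n → A d) → Tree n → A d
  evalT b (leaf i)   = b i
  evalT b (node l r) = evalT b l ⊙ evalT b r

  evalM : ∀ {d n} → (Fin n → A d) → Mon n → A d
  evalM b one      = 𝟙
  evalM b (tree t) = evalT b t

  eval : ∀ {d n} → Poly n → (Fin n → A d) → A d
  eval []            b = 𝟘
  eval ((a , m) ∷ f) b = (a ⊛ evalM b m) ⊕ eval f b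

  IsPolyIdentity : ∀ {n} → ℕ → Poly n → Set (c ⊔ ℓ)
  IsPolyIdentity {n} d f = (b : Fin n → A d) → eval f b ≈A 𝟘

{-# OPTIONS --safe #-}
module Submission where

-- Record a tree monomial t, hung at depth k, by its leaf word: its leaves from left to right, each tagged
-- with its variable and its depth. The depths encode the bracketing, so the leaf word determines t.
-- Fix a word S whose depths are < d and let x_v ∈ A_d have scalar part 0 and entry [i,j,k] equal to 1
-- iff (v , k) is the i-th letter of S and j = i + 1. The product of A′_d passes from level k to level
-- k + 1 and sums over a middle index l, which concatenates factors of S; hence the entry [i,j,k] of t(x)
-- is 1 iff the leaf word of t hung at depth k is the factor S[i..j). Taking for S the leaf word of a
-- monomial m₀ of degree s ≤ d with non-zero coefficient, the entry [0,s,0] of f(x) is that coefficient.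
-- The constant monomial is detected by the scalar part of f(0) instead.

open import Defs
open import Data.Nat using (ℕ; _≤_)
open import Relation.Nullary using (¬_)

open import Algebra.Bundles using (Semiring)
open import Data.Bool using (if_then_else_)
open import Data.Fin as Fin using (Fin; zero; suc; toℕ; fromℕ<; punchIn)
open import Data.Fin.Properties using (toℕ-fromℕ<; toℕ<n; toℕ-injective; punchInᵢ≢i)
open import Data.List using (List; []; _∷_; _++_; drop; length)
open import Data.List.Properties as List
  using (++-assoc; ++-identityʳ; length-++; drop-drop; drop-all; ∷-injective)
open import Data.List.Relation.Unary.All as All using (All; []; _∷_)
open import Data.List.Relation.Unary.All.Properties using (++⁺; drop⁺)
open import Data.Nat as ℕ using (zero; suc; _<_; _<?_; z≤n; s≤s; z<s) renaming (_+_ to _+ℕ_)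
open import Data.Nat.Properties
  using (≤-refl; ≤-trans; <⇒≤; 1+n≰n; m≤m+n; m<m+n; m<n+m; +-suc; +-assoc; +-monoʳ-≤; <-≤-trans; ≤-<-trans)
open import Data.Product using (Σ; ∃; _×_; _,_; proj₁; proj₂)
open import Data.Product.Properties using (≡-dec)
open import Data.Vec.Functional using (Vector)
open import Function using (_∘_)
open import Relation.Binary.Definitions using (DecidableEquality)
open import Relation.Binary.PropositionalEquality
  using (_≡_; _≢_; refl; sym; trans; cong; cong₂; subst; module ≡-Reasoning)
open import Relation.Nullary using (Dec; does; yes; no; _×-dec_; contradiction)
open import Relation.Unary using (Decidable)

Letter : ℕ → Set
Letter n = Fin n × ℕ

depth : ∀ {n} → Letter n → ℕ
depth = proj₂

leafWord : ∀ {n} → Tree n → ℕ → List (Letter n)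
leafWord (leaf v)   k = (v , k) ∷ []
leafWord (node l r) k = leafWord l (suc k) ++ leafWord r (suc k)

length-leafWord : ∀ {n} (t : Tree n) k → length (leafWord t k) ≡ leaves t
length-leafWord (leaf v)   k = refl
length-leafWord (node l r) k =
  trans (length-++ (leafWord l (suc k))) (cong₂ _+ℕ_ (length-leafWord l (suc k)) (length-leafWord r (suc k)))

1≤leaves : ∀ {n} (t : Tree n) → 1 ≤ leaves t
1≤leaves (leaf v)   = s≤s z≤n
1≤leaves (node l r) = ≤-trans (1≤leaves l) (m≤m+n (leaves l) (leaves r))

leafWord-depth< : ∀ {n} (t : Tree n) k → All (λ x → depth x < k +ℕ leaves t) (leafWord t k)
leafWord-depth< (leaf v)   k = m<m+n k z<s ∷ []
leafWord-depth< (node l r) k =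
  ++⁺ (All.map (λ x< → <-≤-trans x< (descend (m<m+n a (1≤leaves r)))) (leafWord-depth< l (suc k)))
      (All.map (λ x< → <-≤-trans x< (descend (m<n+m b (1≤leaves l)))) (leafWord-depth< r (suc k)))
  where
  a b : ℕ
  a = leaves l
  b = leaves r
  descend : ∀ {e} → suc e ≤ a +ℕ b → suc k +ℕ e ≤ k +ℕ (a +ℕ b)
  descend {e} e<a+b = subst (_≤ k +ℕ (a +ℕ b)) (+-suc k e) (+-monoʳ-≤ k e<a+b)

leafWord-++-head-depth : ∀ {n} (t : Tree n) k {ys x xs} → leafWord t k ++ ys ≡ x ∷ xs → k ≤ depth x
leafWord-++-head-depth (leaf v)   k refl = ≤-refl
leafWord-++-head-depth (node l r) k {ys} eq =
  <⇒≤ (leafWord-++-head-depth l (suc k) (trans (sym (++-assoc (leafWord l (suc k)) _ ys)) eq))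

leafWord-++-depth-bound : ∀ {n d} (t : Tree n) k {ys} → All (λ x → depth x < d) (leafWord t k ++ ys) → k < d
leafWord-++-depth-bound (leaf v)   k (k<d ∷ _) = k<d
leafWord-++-depth-bound (node l r) k {ys} all<d =
  <⇒≤ (leafWord-++-depth-bound l (suc k) (subst (All _) (++-assoc (leafWord l (suc k)) _ ys) all<d))

leafWord-++-injective : ∀ {n} (t t′ : Tree n) k {xs ys} →
                        leafWord t k ++ xs ≡ leafWord t′ k ++ ys → t ≡ t′ × xs ≡ ys
leafWord-++-injective (leaf v) (leaf v′) k eq with ∷-injective eq
... | refl , xs≡ys = refl , xs≡ys
leafWord-++-injective (leaf v) (node l r) k {ys = ys} eq =
  contradiction (leafWord-++-head-depth l (suc k) (trans (sym (++-assoc (leafWord l (suc k)) _ ys)) (sym eq))) 1+n≰n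
leafWord-++-injective (node l r) (leaf v) k {xs} eq =
  contradiction (leafWord-++-head-depth l (suc k) (trans (sym (++-assoc (leafWord l (suc k)) _ xs)) eq)) 1+n≰n
leafWord-++-injective (node l r) (node l′ r′) k {xs} {ys} eq
  with leafWord-++-injective l l′ (suc k)
         (trans (sym (++-assoc (leafWord l (suc k)) _ xs)) (trans eq (++-assoc (leafWord l′ (suc k)) _ ys)))
... | refl , eq′ with leafWord-++-injective r r′ (suc k) eq′
...   | refl , xs≡ys = refl , xs≡ys

leafWord-injective : ∀ {n} (t t′ : Tree n) k → leafWord t k ≡ leafWord t′ k → t ≡ t′
leafWord-injective t t′ k eq =
  proj₁ (leafWord-++-injective t t′ k (trans (++-identityʳ (leafWord t k)) (trans eq (sym (++-identityʳ _)))))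

module _ {a} {A : Set a} where
  open ≡-Reasoning

  -- xs is the factor S[i..j) of S. The length condition is not redundant: drop j S = [] for all j ≥ length S.
  Factor : List A → List A → ℕ → ℕ → Set a
  Factor S xs i j = j ≡ i +ℕ length xs × drop i S ≡ xs ++ drop j S

  factor? : DecidableEquality A → ∀ S xs i j → Dec (Factor S xs i j)
  factor? _≟_ S xs i j = j ℕ.≟ i +ℕ length xs ×-dec List.≡-dec _≟_ (drop i S) (xs ++ drop j S)

  factor-≤ : ∀ {S xs i j} → Factor S xs i j → i ≤ j
  factor-≤ {xs = xs} {i} (refl , _) = m≤m+n i (length xs)

  drop-length-++ : ∀ (xs ys : List A) → drop (length xs) (xs ++ ys) ≡ ys
  drop-length-++ []       ys = refl
  drop-length-++ (x ∷ xs) ys = drop-length-++ xs ys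

  factor-++ : ∀ {S xs ys i l j} → Factor S xs i l → Factor S ys l j → Factor S (xs ++ ys) i j
  factor-++ {S} {xs} {ys} {i} {l} {j} (refl , Sᵢ≡) (refl , Sₗ≡) = j≡ , Sᵢ≡′
    where
    j≡ : i +ℕ length xs +ℕ length ys ≡ i +ℕ length (xs ++ ys)
    j≡ = trans (+-assoc i (length xs) (length ys)) (cong (i +ℕ_) (sym (length-++ xs)))
    Sᵢ≡′ : drop i S ≡ (xs ++ ys) ++ drop j S
    Sᵢ≡′ = begin
      drop i S                  ≡⟨ Sᵢ≡ ⟩
      xs ++ drop l S            ≡⟨ cong (xs ++_) Sₗ≡ ⟩
      xs ++ ys ++ drop j S      ≡⟨ ++-assoc xs ys _ ⟨
      (xs ++ ys) ++ drop j S    ∎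

  factor-++⁻ : ∀ {S xs ys i j} → Factor S (xs ++ ys) i j → ∃ λ l → Factor S xs i l × Factor S ys l j
  factor-++⁻ {S} {xs} {ys} {i} {j} (refl , Sᵢ≡) = i +ℕ length xs , (refl , Sᵢ≡′) , (j≡ , Sₗ≡)
    where
    j≡ : i +ℕ length (xs ++ ys) ≡ i +ℕ length xs +ℕ length ys
    j≡ = trans (cong (i +ℕ_) (length-++ xs)) (sym (+-assoc i (length xs) (length ys)))
    Sₗ≡ : drop (i +ℕ length xs) S ≡ ys ++ drop j S
    Sₗ≡ = begin
      drop (i +ℕ length xs) S                    ≡⟨ drop-drop i (length xs) S ⟨
      drop (length xs) (drop i S)                ≡⟨ cong (drop (length xs)) Sᵢ≡ ⟩
      drop (length xs) ((xs ++ ys) ++ drop j S)  ≡⟨ cong (drop (length xs)) (++-assoc xs ys _) ⟩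
      drop (length xs) (xs ++ ys ++ drop j S)    ≡⟨ drop-length-++ xs _ ⟩
      ys ++ drop j S                             ∎
    Sᵢ≡′ : drop i S ≡ xs ++ drop (i +ℕ length xs) S
    Sᵢ≡′ = trans Sᵢ≡ (trans (++-assoc xs ys _) (cong (xs ++_) (sym Sₗ≡)))

  factor-whole : ∀ S → Factor S S 0 (length S)
  factor-whole S = refl , sym (trans (cong (S ++_) (drop-all (length S) S ≤-refl)) (++-identityʳ S))

  factor-whole⁻ : ∀ {S xs} → Factor S xs 0 (length S) → xs ≡ S
  factor-whole⁻ {S} {xs} (_ , S≡) =
    sym (trans S≡ (trans (cong (xs ++_) (drop-all (length S) S ≤-refl)) (++-identityʳ xs)))

module Indicator {c ℓ} (R : Semiring c ℓ) where
  open Semiring R renaming (refl to ≈-refl; trans to ≈-trans)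
  open import Algebra.Properties.Semiring.Sum R using (sum; sum-cong-≋; sum-replicate-zero; sum-remove)
  open import Relation.Binary.Reasoning.Setoid setoid

  χ : ∀ {p} {P : Set p} → Dec P → Carrier
  χ P? = if does P? then 1# else 0#

  χ-yes : ∀ {p} {P : Set p} → P → (P? : Dec P) → χ P? ≈ 1#
  χ-yes _ (yes _) = ≈-refl
  χ-yes p (no ¬p) = contradiction p ¬p

  χ-no : ∀ {p} {P : Set p} → ¬ P → (P? : Dec P) → χ P? ≈ 0#
  χ-no ¬p (yes p) = contradiction p ¬p
  χ-no _  (no _)  = ≈-refl

  χ-×-dec : ∀ {p q} {P : Set p} {Q : Set q} (P? : Dec P) (Q? : Dec Q) → χ P? * χ Q? ≈ χ (P? ×-dec Q?)
  χ-×-dec (yes _) (yes _) = *-identityˡ 1#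
  χ-×-dec (yes _) (no _)  = *-identityˡ 0#
  χ-×-dec (no _)  _       = zeroˡ _

  sum-zero : ∀ {k} (g : Vector Carrier k) → (∀ l → g l ≈ 0#) → sum g ≈ 0#
  sum-zero {k} g g≈0 = ≈-trans (sum-cong-≋ g≈0) (sum-replicate-zero k)

  sum-single : ∀ {k} (g : Vector Carrier k) i → (∀ l → l ≢ i → g l ≈ 0#) → sum g ≈ g i
  sum-single {suc k} g i g≈0 = begin
    sum g                      ≈⟨ sum-remove {i = i} g ⟩
    g i + sum (g ∘ punchIn i)  ≈⟨ +-congˡ (sum-zero _ (λ l → g≈0 _ (punchInᵢ≢i i l))) ⟩
    g i + 0#                   ≈⟨ +-identityʳ (g i) ⟩
    g i                        ∎

  sum-χ-unique : ∀ {k p q} {P : Fin k → Set p} {Q : Set q} (P? : Decidable P) (Q? : Dec Q) →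
                 (∀ {l l′} → P l → P l′ → l ≡ l′) → (∀ {l} → P l → Q) → (Q → Σ (Fin k) P) →
                 sum (χ ∘ P?) ≈ χ Q?
  sum-χ-unique P? (yes q) unique _ witness with witness q
  ... | l₀ , p₀ =
    ≈-trans (sum-single _ l₀ (λ l l≢l₀ → χ-no (λ p → l≢l₀ (unique p p₀)) (P? l))) (χ-yes p₀ (P? l₀))
  sum-χ-unique P? (no ¬q) _ P⇒Q _ = sum-zero _ (λ l → χ-no (¬q ∘ P⇒Q) (P? l))

module _ {c ℓ} (F : Field c ℓ) where
  open Field F hiding (zero) renaming (refl to ≈-refl; sym to ≈-sym; trans to ≈-trans)
  open Indicator semiring
  open import Algebra.Properties.Semiring.Sum semiring using (sum; sum-cong-≋)
  open import Relation.Binary.Reasoning.Setoid setoid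

  Σ[<]≡sum : ∀ k (g : Fin k → Carrier) → Σ[<_] F k g ≡ sum g
  Σ[<]≡sum zero    g = refl
  Σ[<]≡sum (suc k) g = cong (g zero +_) (Σ[<]≡sum k (g ∘ suc))

  coeff-by-separating-coordinate :
    ∀ {d n} (b : Fin n → A F d) (π : A F d → Carrier) →
    π (𝟘 F) ≈ 0# → (∀ a x y → π (_⊕_ F (_⊛_ F a x) y) ≈ a * π x + π y) →
    ∀ m₀ → π (evalM F b m₀) ≈ 1# → (∀ m → m ≢ m₀ → π (evalM F b m) ≈ 0#) →
    ∀ f → π (eval F f b) ≈ coeff F f m₀
  coeff-by-separating-coordinate b π π𝟘 π-linear m₀ π-m₀ π-other = go
    where
    go : ∀ f → π (eval F f b) ≈ coeff F f m₀
    go [] = π𝟘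
    go ((a , m) ∷ f) with m ≟M m₀
    ... | yes refl = ≈-trans (π-linear a _ _) (+-cong (≈-trans (*-congˡ π-m₀) (*-identityʳ a)) (go f))
    ... | no m≢m₀  = ≈-trans (π-linear a _ _)
                       (≈-trans (+-cong (≈-trans (*-congˡ (π-other m m≢m₀)) (zeroʳ a)) (go f)) (+-identityˡ _))

  ⊙-null-scalars : ∀ {d} (x y : A F d) → proj₂ x ≈ 0# → proj₂ y ≈ 0# →
                   ∀ i j k → proj₁ (_⊙_ F x y) i j k ≈ _∘′_ F (proj₁ x) (proj₁ y) i j k
  ⊙-null-scalars (x , α) (y , β) α≈0 β≈0 i j k = begin
    (_∘′_ F x y i j k + α * y i j k) + β * x i j k  ≈⟨ +-cong (+-congˡ (null α≈0)) (null β≈0) ⟩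
    (_∘′_ F x y i j k + 0#) + 0#                    ≈⟨ ≈-trans (+-identityʳ _) (+-identityʳ _) ⟩
    _∘′_ F x y i j k                                ∎
    where
    null : ∀ {γ u} → γ ≈ 0# → γ * u ≈ 0#
    null γ≈0 = ≈-trans (*-congʳ γ≈0) (zeroˡ _)

  scalar-evalT : ∀ {d n} (b : Fin n → A F d) → (∀ v → proj₂ (b v) ≈ 0#) →
                 ∀ t → proj₂ (evalT F b t) ≈ 0#
  scalar-evalT b b≈0 (leaf v)   = b≈0 v
  scalar-evalT b b≈0 (node l r) = ≈-trans (*-congʳ (scalar-evalT b b≈0 l)) (zeroˡ _)

  scalar-eval : ∀ {d n} (b : Fin n → A F d) → (∀ v → proj₂ (b v) ≈ 0#) →
                ∀ f → proj₂ (eval F f b) ≈ coeff F f one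
  scalar-eval b b≈0 =
    coeff-by-separating-coordinate b proj₂ ≈-refl (λ _ _ _ → ≈-refl) one ≈-refl separates
    where
    separates : ∀ m → m ≢ one → proj₂ (evalM F b m) ≈ 0#
    separates one      m≢one = contradiction refl m≢one
    separates (tree t) _     = scalar-evalT b b≈0 t

  module LeafWordPoint {d n} (S : List (Letter n)) (S<d : All (λ x → depth x < d) S) where
    occ? : ∀ xs (i j : Fin (suc d)) → Dec (Factor S xs (toℕ i) (toℕ j))
    occ? xs i j = factor? (≡-dec Fin._≟_ ℕ._≟_) S xs (toℕ i) (toℕ j)

    occ : List (Letter n) → Fin (suc d) → Fin (suc d) → Carrier
    occ xs i j = χ (occ? xs i j)

    occ-++ : ∀ xs ys i j → sum (λ l → occ xs i l * occ ys l j) ≈ occ (xs ++ ys) i j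
    occ-++ xs ys i j = begin
      sum (λ l → occ xs i l * occ ys l j)  ≈⟨ sum-cong-≋ (λ l → χ-×-dec (occ? xs i l) (occ? ys l j)) ⟩
      sum (χ ∘ through?)                   ≈⟨ sum-χ-unique through? (occ? (xs ++ ys) i j)
                                                unique (λ (p , q) → factor-++ p q) split ⟩
      occ (xs ++ ys) i j                   ∎
      where
      Through : Fin (suc d) → Set
      Through l = Factor S xs (toℕ i) (toℕ l) × Factor S ys (toℕ l) (toℕ j)

      through? : Decidable Through
      through? l = occ? xs i l ×-dec occ? ys l j

      unique : ∀ {l l′} → Through l → Through l′ → l ≡ l′
      unique ((l≡ , _) , _) ((l′≡ , _) , _) = toℕ-injective (trans l≡ (sym l′≡))

      split : Factor S (xs ++ ys) (toℕ i) (toℕ j) → Σ (Fin (suc d)) Through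
      split xs++ys with factor-++⁻ xs++ys
      ... | l , p , q = fromℕ< l<1+d , subst (Factor S xs (toℕ i)) (sym l≡) p
                                     , subst (λ l → Factor S ys l (toℕ j)) (sym l≡) q
        where
        l<1+d : l < suc d
        l<1+d = ≤-<-trans (factor-≤ q) (toℕ<n j)
        l≡ : toℕ (fromℕ< l<1+d) ≡ l
        l≡ = toℕ-fromℕ< l<1+d

    Represents : A′ F d → Tree n → Set ℓ
    Represents x t = ∀ i j k → x i j k ≈ occ (leafWord t (toℕ k)) i j

    ∘′-represents : ∀ {x y} l r → Represents x l → Represents y r → Represents (_∘′_ F x y) (node l r)
    ∘′-represents {x} {y} l r x∼l y∼r i j k with suc (toℕ k) <? d
    ... | yes k+1<d = begin
      Σ[<_] F (suc d) (λ m → x i m k′ * y m j k′)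
        ≡⟨ Σ[<]≡sum (suc d) (λ m → x i m k′ * y m j k′) ⟩
      sum (λ m → x i m k′ * y m j k′)
        ≈⟨ sum-cong-≋ (λ m → *-cong (deeper l x∼l i m) (deeper r y∼r m j)) ⟩
      sum (λ m → occ Lₗ i m * occ Lᵣ m j)
        ≈⟨ occ-++ Lₗ Lᵣ i j ⟩
      occ (Lₗ ++ Lᵣ) i j
        ∎
      where
      k′ : Fin d
      k′ = fromℕ< k+1<d
      Lₗ Lᵣ : List (Letter n)
      Lₗ = leafWord l (suc (toℕ k))
      Lᵣ = leafWord r (suc (toℕ k))
      deeper : ∀ {z} t → Represents z t → ∀ i j → z i j k′ ≈ occ (leafWord t (suc (toℕ k))) i j
      deeper {z} t z∼t i j = subst (λ K → z i j k′ ≈ occ (leafWord t K) i j) (toℕ-fromℕ< k+1<d) (z∼t i j k′)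
    ... | no k+1≮d = ≈-sym (χ-no too-deep (occ? (leafWord (node l r) (toℕ k)) i j))
      where
      too-deep : ¬ Factor S (leafWord (node l r) (toℕ k)) (toℕ i) (toℕ j)
      too-deep (_ , Sᵢ≡) = k+1≮d (leafWord-++-depth-bound l (suc (toℕ k))
        (subst (All _) (trans Sᵢ≡ (++-assoc (leafWord l (suc (toℕ k))) _ _)) (drop⁺ (toℕ i) S<d)))

    point : Fin n → A F d
    point v = (λ i j k → occ (leafWord (leaf v) (toℕ k)) i j) , 0#

    evalT-represents : ∀ t → Represents (proj₁ (evalT F point t)) t
    evalT-represents (leaf v)   i j k = ≈-refl
    evalT-represents (node l r) i j k = ≈-trans
      (⊙-null-scalars (evalT F point l) (evalT F point r) (scalar l) (scalar r) i j k)
      (∘′-represents l r (evalT-represents l) (evalT-represents r) i j k)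
      where
      scalar : ∀ t → proj₂ (evalT F point t) ≈ 0#
      scalar = scalar-evalT point (λ _ → ≈-refl)

  module MonomialWitness {d n} (m₀ : Tree n) (m₀≤d : leaves m₀ ≤ suc d) where
    S : List (Letter n)
    S = leafWord m₀ 0

    open LeafWordPoint S (All.map (λ x< → <-≤-trans x< m₀≤d) (leafWord-depth< m₀ 0)) public

    last : Fin (suc (suc d))
    last = fromℕ< (s≤s m₀≤d)

    toℕ-last : toℕ last ≡ length S
    toℕ-last = trans (toℕ-fromℕ< (s≤s m₀≤d)) (sym (length-leafWord m₀ 0))

    entry : A F (suc d) → Carrier
    entry x = proj₁ x zero last zero

    separates : ∀ m → m ≢ tree m₀ → entry (evalM F point m) ≈ 0#
    separates one      _    = ≈-refl
    separates (tree t) t≢m₀ =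
      ≈-trans (evalT-represents t zero last zero) (χ-no not-whole (occ? (leafWord t 0) zero last))
      where
      not-whole : ¬ Factor S (leafWord t 0) 0 (toℕ last)
      not-whole p = t≢m₀ (cong tree (leafWord-injective t m₀ 0
                      (factor-whole⁻ (subst (Factor S (leafWord t 0) 0) toℕ-last p))))

    entry-eval : ∀ f → entry (eval F f point) ≈ coeff F f (tree m₀)
    entry-eval =
      coeff-by-separating-coordinate point entry ≈-refl (λ _ _ _ → ≈-refl) (tree m₀) whole separates
      where
      whole : entry (evalM F point (tree m₀)) ≈ 1#
      whole = ≈-trans (evalT-represents m₀ zero last zero)
                (χ-yes (subst (Factor S S 0) (sym toℕ-last) (factor-whole S)) (occ? S zero last))

mainTheorem7 : ∀ {c ℓ} (F : Field c ℓ) (d : ℕ) → 1 ≤ d → (n : ℕ) (f : Poly F n) →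
                 NonZeroPoly F f → TotalDegree≤ F f d → ¬ IsPolyIdentity F d f
mainTheorem7 F d _ n f (one , c≉0) _ isPI =
  c≉0 (≈-trans (≈-sym (scalar-eval F origin (λ _ → ≈-refl) f)) (proj₂ (isPI origin)))
  where
  open Field F using () renaming (refl to ≈-refl; sym to ≈-sym; trans to ≈-trans)
  origin : Fin n → A F d
  origin _ = 𝟘 F
mainTheorem7 F (suc d) (s≤s z≤n) n f (tree m₀ , c≉0) deg isPI =
  c≉0 (≈-trans (≈-sym (entry-eval f)) (proj₁ (isPI point) zero last zero))
  where
  open Field F using () renaming (sym to ≈-sym; trans to ≈-trans)
  open MonomialWitness F m₀ (deg (tree m₀) c≉0)
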